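{- Let $\mathbb P$ be a large-tree forcing notion, $n\ge1$, $P\in\mathbf{LC}_n(\mathbb P)$, and let $D\subseteq\mathbb P\times_{\mathsf E_0}\mathbb P$ be open dense in $\mathbb P\times_{\mathsf E_0}\mathbb P$. Then there is $Q\in\mathbf{LC}_n(\mathbb P)$ with $Q\subseteq_n P$ such that $\langle Q(\to s),Q(\to t)\rangle\in D$ whenever $s,t\in2^n$ and $s(n-1)\ne t(n-1)$.
   Context: For $s,t\in 2^{<\omega}$ with $\mathrm{lh}(s)\le\mathrm{lh}(t)$, $s\cdot t$ has length $\mathrm{lh}(t)$ with $(s\cdot t)(k)=t(k)+s(k)\bmod2$ for $k<\mathrm{lh}(s)$, $=t(k)$ otherwise; if $\mathrm{lh}(s)>\mathrm{lh}(t)$, $s\cdot t=(s{\restriction}\mathrm{lh}(t))\cdot t$; $s\cdot T=\{s\cdot t:t\in T\}$; $T{\restriction}s=\{t\in T:s\subseteq t\lor t\subseteq s\}$. The stem of a perfect tree $T$ is the largest $s\in T$ with $T=T{\restriction}s$. $\mathbf{LT}$ is the set of perfect trees $T\subseteq2^{<\omega}$ for which there are nonempty strings $q^m_i$ ($m<\omega,i<2$) with $\mathrm{lh}(q^m_0)=\mathrm{lh}(q^m_1)$, $q^m_i(0)=i$, such that $T$ consists of all initial segments of strings $\mathrm{stem}(T)^\frown q^0_{i(0)}{}^\frown\cdots{}^\frown q^m_{i(m)}$; $\mathrm{spl}_0(T)=\mathrm{lh}(\mathrm{stem}(T))$, $\mathrm{spl}_{m+1}(T)=\mathrm{spl}_m(T)+\mathrm{lh}(q^m_0)$.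 For $T\in\mathbf{LT}$: $T(\to i)=T{\restriction}(\mathrm{stem}(T)^\frown i)$ and for $s\in2^m$, $T(\to s)=(\cdots(T(\to s(0)))\cdots)(\to s(m-1))$. $S\subseteq_n T$ means $S\subseteq T$ and $\mathrm{spl}_k(S)=\mathrm{spl}_k(T)$ for $k<n$. A large-tree forcing notion is a set $\mathbb P\subseteq\mathbf{LT}$ closed under $T\mapsto T{\restriction}u$ ($u\in T$) and $T\mapsto s\cdot T$ ($s\in2^{<\omega}$). $\mathbf{LC}_n(\mathbb P)=\{T\in\mathbf{LT}:\forall s\in2^n\,(T(\to s)\in\mathbb P)\}$. The conditional product $\mathbb P\times_{\mathsf E_0}\mathbb P$ is the set of pairs $\langle T,T'\rangle$ with $T,T'\in\mathbb P$ such that $T'=s\cdot T$ for some $s\in2^{<\omega}$, ordered componentwise: $\langle S,S'\rangle\le\langle T,T'\rangle$ iff $S\subseteq T$ and $S'\subseteq T'$. Open dense: every condition has an extension in $D$, and every extension of an element of $D$ (within the forcing) is in $D$. -}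

module Defs where

open import Data.Bool using (Bool; true; false; _xor_)
open import Data.Nat using (ℕ; zero; suc; _+_; _<_)
open import Data.List using (List; []; _∷_; _++_; length)
open import Data.Vec using (Vec; toList; last)
open import Data.Product using (Σ; ∃; _×_; _,_)
open import Data.Sum using (_⊎_)
open import Relation.Binary.PropositionalEquality using (_≡_)
open import Relation.Nullary using (¬_)

Str : Set
Str = List Bool

_⊑_ : Str → Str → Set
s ⊑ t = ∃ λ u → s ++ u ≡ t

-- subsets of 2^{<ω}
Tree : Set₁
Tree = Str → Set

_⊆_ : Tree → Tree → Set
S ⊆ T = ∀ t → S t → T t

_≐_ : Tree → Tree → Set
S ≐ T = S ⊆ T × T ⊆ S

IsPerfect : Tree → Set
IsPerfect T =
  T [] ×
  (∀ s t → s ⊑ t → T t → T s) ×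
  (∀ t → T t → Σ Str λ u → Σ Str λ v →
      T u × T v × t ⊑ u × t ⊑ v × ¬ (u ⊑ v) × ¬ (v ⊑ u))

restrict : Tree → Str → Tree
restrict T s t = T t × (s ⊑ t ⊎ t ⊑ s)

dotS : Str → Str → Str
dotS []       t        = t
dotS (_ ∷ _)  []       = []
dotS (a ∷ s)  (b ∷ t)  = (b xor a) ∷ dotS s t

dotT : Str → Tree → Tree
dotT s T x = ∃ λ t → T t × x ≡ dotS s t

data StartsWith (i : Bool) : Str → Set where
  sw : ∀ r → StartsWith i (i ∷ r)

-- the data witnessing membership in LT: stem and the strings q^m_i
record LTData : Set where
  field
    stem  : Str
    q     : ℕ → Bool → Str
    q-len : ∀ m → length (q m false) ≡ length (q m true)
    q-hd  : ∀ m i → StartsWith i (q m i)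
open LTData public

blocks : (ℕ → Bool → Str) → (ℕ → Bool) → ℕ → Str
blocks q f zero    = []
blocks q f (suc m) = q 0 (f 0) ++ blocks (λ k → q (suc k)) (λ k → f (suc k)) m

treeOf : LTData → Tree
treeOf d t = ∃ λ (m : ℕ) → ∃ λ (f : ℕ → Bool) → t ⊑ (stem d ++ blocks (q d) f m)

-- T ∈ LT, witnessed by data d (the data is uniquely determined by T;
-- stem d is then the stem of T)
IsLT : Tree → LTData → Set
IsLT T d = IsPerfect T × (T ≐ treeOf d)

spl : LTData → ℕ → ℕ
spl d zero    = length (stem d)
spl d (suc k) = spl d k + length (q d k false)

-- LT data of T(→ i): stem becomes stem ⌢ q^0_i, blocks shift
arrowD : LTData → Bool → LTData
arrowD d i = record
  { stem  = stem d ++ q d 0 i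
  ; q     = λ m → q d (suc m)
  ; q-len = λ m → q-len d (suc m)
  ; q-hd  = λ m → q-hd d (suc m)
  }

-- T(→ s) = (...(T(→ s(0)))...)(→ s(m-1)),  with T(→ i) = T ↾ (stem(T) ⌢ i)
arrow : Tree → LTData → Str → Tree
arrow T d []      = T
arrow T d (i ∷ s) = arrow (restrict T (stem d ++ (i ∷ []))) (arrowD d i) s

SubN : ℕ → Tree → LTData → Tree → LTData → Set
SubN n S dS T dT = S ⊆ T × (∀ k → k < n → spl dS k ≡ spl dT k)

-- large-tree forcing notion (a set of trees; sets are extensional)
record LargeTreeForcing (P : Tree → Set) : Set₁ where
  field
    ext      : ∀ S T → S ≐ T → P S → P T
    inLT     : ∀ T → P T → ∃ λ d → IsLT T d
    restrCl  : ∀ T u → P T → T u → P (restrict T u)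
    dotCl    : ∀ T s → P T → P (dotT s T)

LC : ℕ → (Tree → Set) → Tree → LTData → Set
LC n P T d = IsLT T d × (∀ (s : Vec Bool n) → P (arrow T d (toList s)))

CondProd : (Tree → Set) → Tree → Tree → Set
CondProd P T T' = P T × P T' × ∃ λ s → T' ≐ dotT s T

_≤₂_ : (Tree × Tree) → (Tree × Tree) → Set
(S , S') ≤₂ (T , T') = S ⊆ T × S' ⊆ T'

-- D ⊆ P ×_{E0} P is open dense in P ×_{E0} P
-- (D is a set of pairs of trees, hence extensional)
OpenDense : (Tree → Set) → (Tree → Tree → Set) → Set₁
OpenDense P D =
  (∀ T T' → D T T' → CondProd P T T') ×
  (∀ S S' T T' → S ≐ T → S' ≐ T' → D S S' → D T T') ×
  (∀ T T' → CondProd P T T' →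
     ∃ λ S → ∃ λ S' → CondProd P S S' × D S S' × (S , S') ≤₂ (T , T')) ×
  (∀ S S' T T' → D T T' → CondProd P S S' → (S , S') ≤₂ (T , T') → D S S')

module Submission where

-- Enumerate the finitely many
-- pairs (s, t) of strings in 2^{m+1} and shrink the tree one pair at a time; pairs with
-- s(m) = t(m) need nothing, and by openness of D a pair handled earlier stays
-- handled, because shrinking only shrinks the cones Q(→u).  To handle a pair with
-- s(m) ≠ t(m): the cones Q(→s), Q(→t) are E₀-related, so density gives
-- ⟨S, σ·S⟩ ∈ D below them; passing to a deep cone S₀ of S we may assume the stem
-- a of S₀ is longer than both σ and the stems of the cones.  We then graft:
-- keep the first m splitting levels of Q, lengthen the level-m blocks q^m_i by
-- suitable tails e_i and continue with the splitting strings of S₀.  The new tree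
-- Q' ⊆_{m+1} Q has Q'(→s) = S₀ and Q'(→t) = σ·S₀, and every cone Q'(→u) is a
-- translate of one of these two, hence in ℙ.

open import Defs
open import Data.Bool using (Bool; true; false; not; _xor_; _≟_)
open import Data.Bool.Properties using (xor-assoc; xor-comm; xor-same; xor-identityʳ; not-¬; ¬-not)
open import Data.Nat using (ℕ; zero; suc; pred; _+_; _<_; _≤_; z≤n; s≤s)
open import Data.Nat.Properties
  using (≤-total; ≤-trans; ≤-reflexive; m≤m+n; m≤n+m; +-suc; +-cancelˡ-≡; <-≤-trans; n≤1+n; n<1+n)
open import Data.List using (List; []; _∷_; _++_; length; replicate; map; cartesianProduct)
open import Data.List.Properties using (++-assoc; ++-identityʳ; length-++; ++-cancelˡ; ∷-injective; ∷-injectiveˡ; length-replicate)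
open import Data.List.Membership.Propositional using (_∈_)
open import Data.List.Membership.Propositional.Properties using (∈-++⁺ˡ; ∈-++⁺ʳ; ∈-map⁺; ∈-cartesianProduct⁺)
open import Data.List.Relation.Unary.All as All using (All; []; _∷_)
open import Data.List.Relation.Unary.Any using (here)
open import Data.Vec using (Vec; toList; last) renaming ([] to []ᵥ; _∷_ to _∷ᵥ_)
open import Data.Vec.Properties using (length-toList)
open import Data.Product using (Σ; ∃; _×_; _,_; proj₁; proj₂; uncurry)
open import Data.Sum using (_⊎_; inj₁; inj₂)
open import Relation.Nullary using (¬_; yes; no; contradiction)
open import Relation.Binary.PropositionalEquality
  using (_≡_; _≢_; refl; sym; trans; cong; cong₂; subst; module ≡-Reasoning)

⊑-refl : ∀ x → x ⊑ x
⊑-refl x = [] , ++-identityʳ x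

⊑-trans : ∀ {x y z} → x ⊑ y → y ⊑ z → x ⊑ z
⊑-trans {x} (u , refl) (v , refl) = u ++ v , sym (++-assoc x u v)

⊑-++ : ∀ x w → x ⊑ (x ++ w)
⊑-++ x w = w , refl

[]⊑ : ∀ x → [] ⊑ x
[]⊑ x = x , refl

⊑-∷ : ∀ {b x y} → x ⊑ y → (b ∷ x) ⊑ (b ∷ y)
⊑-∷ (u , p) = u , cong (_ ∷_) p

⊑-++ˡ : ∀ p {x y} → x ⊑ y → (p ++ x) ⊑ (p ++ y)
⊑-++ˡ p {x} (u , refl) = u , ++-assoc p x u

⊑-cancelˡ : ∀ p {x y} → (p ++ x) ⊑ (p ++ y) → x ⊑ y
⊑-cancelˡ p {x} (u , e) = u , ++-cancelˡ p _ _ (trans (sym (++-assoc p x u)) e)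

⊑-shorter : ∀ {x z y} → x ⊑ y → z ⊑ y → length z ≤ length x → z ⊑ x
⊑-shorter {x} {[]} _ _ _ = []⊑ x
⊑-shorter {[]} {c ∷ z} _ _ ()
⊑-shorter {b ∷ x} {c ∷ z} {[]} (u , ()) _ _
⊑-shorter {b ∷ x} {c ∷ z} {y ∷ ys} (u , p) (v , q) (s≤s l)
  with ∷-injective p | ∷-injective q
... | refl , p' | refl , q' = ⊑-∷ (⊑-shorter (u , p') (v , q') l)

⊑-comparable : ∀ {x z y} → x ⊑ y → z ⊑ y → z ⊑ x ⊎ x ⊑ z
⊑-comparable {x} {z} p q with ≤-total (length z) (length x)
... | inj₁ l = inj₁ (⊑-shorter p q l)
... | inj₂ l = inj₂ (⊑-shorter q p l)

branches-incomparable : ∀ p i {r r'} → ¬ ((p ++ (i ∷ r)) ⊑ (p ++ (not i ∷ r')))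
branches-incomparable p i pre = not-¬ refl (∷-injectiveˡ (proj₂ (⊑-cancelˡ p pre)))

-- The translation action  s · t  of 2^{<ω} on itself

xor-cancelʳ : ∀ b a → (b xor a) xor a ≡ b
xor-cancelʳ b a = trans (xor-assoc b a a) (trans (cong (b xor_) (xor-same a)) (xor-identityʳ b))

xor-cancelˡ : ∀ b a → a xor (b xor a) ≡ b
xor-cancelˡ b a = trans (cong (a xor_) (xor-comm b a)) (trans (sym (xor-assoc a a b)) (cong (_xor b) (xor-same a)))

dotS-length : ∀ τ x → length (dotS τ x) ≡ length x
dotS-length [] x = refl
dotS-length (a ∷ τ) [] = refl
dotS-length (a ∷ τ) (b ∷ x) = cong suc (dotS-length τ x)

dotS-involutive : ∀ τ x → dotS τ (dotS τ x) ≡ x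
dotS-involutive [] x = refl
dotS-involutive (a ∷ τ) [] = refl
dotS-involutive (a ∷ τ) (b ∷ x) = cong₂ _∷_ (xor-cancelʳ b a) (dotS-involutive τ x)

dotS-difference : ∀ x y → length x ≡ length y → dotS (dotS x y) x ≡ y
dotS-difference [] [] _ = refl
dotS-difference (a ∷ x) (b ∷ y) e = cong₂ _∷_ (xor-cancelˡ b a) (dotS-difference x y (cong pred e))

dotS-++ : ∀ τ p r → length τ ≤ length p → dotS τ (p ++ r) ≡ dotS τ p ++ r
dotS-++ [] p r _ = refl
dotS-++ (a ∷ τ) (b ∷ p) r (s≤s l) = cong (_ ∷_) (dotS-++ τ p r l)

dotS-mono : ∀ τ {x y} → x ⊑ y → dotS τ x ⊑ dotS τ y
dotS-mono [] pre = pre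
dotS-mono (a ∷ τ) {[]} _ = []⊑ _
dotS-mono (a ∷ τ) {b ∷ x} (w , refl) = ⊑-∷ (dotS-mono τ (w , refl))

≐-refl : ∀ {T} → T ≐ T
≐-refl = (λ t p → p) , (λ t p → p)

≐-sym : ∀ {S T} → S ≐ T → T ≐ S
≐-sym (a , b) = b , a

≐-trans : ∀ {S T U} → S ≐ T → T ≐ U → S ≐ U
≐-trans (a , b) (c , d) = (λ t p → c t (a t p)) , (λ t p → b t (d t p))

⊆-trans : ∀ {S T U} → S ⊆ T → T ⊆ U → S ⊆ U
⊆-trans a c = λ t p → c t (a t p)

dotT-mono : ∀ τ {S T} → S ⊆ T → dotT τ S ⊆ dotT τ T
dotT-mono τ h x (t , p , e) = t , h t p , e

dotT-cong : ∀ τ {S T} → S ≐ T → dotT τ S ≐ dotT τ T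
dotT-cong τ (a , b) = dotT-mono τ a , dotT-mono τ b

restrict-cong : ∀ {S T} u → S ≐ T → restrict S u ≐ restrict T u
restrict-cong u (a , b) = (λ t (p , c) → a t p , c) , (λ t (p , c) → b t p , c)

withStem : LTData → Str → LTData
withStem d a = record d { stem = a }

head-⊑ : ∀ {i x} → StartsWith i x → (i ∷ []) ⊑ x
head-⊑ (sw r) = r , refl

head-agrees : ∀ {i j x} r → StartsWith j x → (i ∷ []) ⊑ (x ++ r) → j ≡ i
head-agrees r (sw x') (u , e) = sym (∷-injectiveˡ e)

blocks-ext : ∀ q q' f M → (∀ k i → q k i ≡ q' k i) → blocks q f M ≡ blocks q' f M
blocks-ext q q' f zero h = refl
blocks-ext q q' f (suc M) h =
  cong₂ _++_ (h 0 (f 0)) (blocks-ext (λ k → q (suc k)) (λ k → q' (suc k)) (λ k → f (suc k)) M (λ k → h (suc k)))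

blocks-prefix : ∀ q f M → blocks q f M ⊑ blocks q f (suc M)
blocks-prefix q f zero = []⊑ _
blocks-prefix q f (suc M) = ⊑-++ˡ (q 0 (f 0)) (blocks-prefix (λ k → q (suc k)) (λ k → f (suc k)) M)

treeOf-ext : ∀ d d' → stem d ≡ stem d' → (∀ k i → q d k i ≡ q d' k i) → treeOf d ≐ treeOf d'
treeOf-ext d d' es eq = into d d' es eq , into d' d (sym es) (λ k i → sym (eq k i))
  where
  into : ∀ d d' → stem d ≡ stem d' → (∀ k i → q d k i ≡ q d' k i) → treeOf d ⊆ treeOf d'
  into d d' es eq t (M , f , p) = M , f , subst (t ⊑_) (cong₂ _++_ es (blocks-ext (q d) (q d') f M eq)) p

redirect : (ℕ → Bool) → ℕ → Bool → ℕ → Bool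
redirect f zero b zero = b
redirect f zero b (suc k) = f (suc k)
redirect f (suc M) b zero = f 0
redirect f (suc M) b (suc k) = redirect (λ k → f (suc k)) M b k

blocks-redirect : ∀ q f M b → blocks q (redirect f M b) (suc M) ≡ blocks q f M ++ q M b
blocks-redirect q f zero b = ++-identityʳ (q 0 b)
blocks-redirect q f (suc M) b =
  trans (cong (q 0 (f 0) ++_) (blocks-redirect (λ k → q (suc k)) (λ k → f (suc k)) M b))
        (sym (++-assoc (q 0 (f 0)) _ _))

-- The two blocks of a level start with different bits, so they branch apart.
blocks-incomparable : ∀ d N M i → ¬ ((N ++ q d M i) ⊑ (N ++ q d M (not i)))
blocks-incomparable d N M i with q d M i | q-hd d M i | q d M (not i) | q-hd d M (not i)
... | .(i ∷ r) | sw r | .(not i ∷ r') | sw r' = branches-incomparable N i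

-- Every tree generated by LT data is perfect: a node below the M-th level
-- extends to both of its M-th blocks.
treeOf-perfect : ∀ d → IsPerfect (treeOf d)
treeOf-perfect d = (0 , (λ _ → false) , []⊑ _) , (λ s t p (M , f , r) → M , f , ⊑-trans p r) , split
  where
  grow : ∀ f M b → treeOf d ((stem d ++ blocks (q d) f M) ++ q d M b)
  grow f M b = suc M , redirect f M b , subst (_⊑ (stem d ++ blocks (q d) (redirect f M b) (suc M))) path (⊑-refl _)
    where
    path : stem d ++ blocks (q d) (redirect f M b) (suc M) ≡ (stem d ++ blocks (q d) f M) ++ q d M b
    path = trans (cong (stem d ++_) (blocks-redirect (q d) f M b)) (sym (++-assoc (stem d) _ _))
  split : ∀ t → treeOf d t → Σ Str λ u → Σ Str λ v →
    treeOf d u × treeOf d v × t ⊑ u × t ⊑ v × ¬ (u ⊑ v) × ¬ (v ⊑ u)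
  split t (M , f , p) =
    N ++ q d M false , N ++ q d M true , grow f M false , grow f M true ,
    ⊑-trans p (⊑-++ N _) , ⊑-trans p (⊑-++ N _) ,
    blocks-incomparable d N M false , blocks-incomparable d N M true
    where
    N : Str
    N = stem d ++ blocks (q d) f M

-- Cones T(→ s) of trees generated by LT data

arrowsD : LTData → Str → LTData
arrowsD d [] = d
arrowsD d (i ∷ s) = arrowsD (arrowD d i) s

-- The node stem ⌢ i lies below the first block in direction i, so it is in the tree.
stem-turn-⊑ : ∀ d i → (stem d ++ (i ∷ [])) ⊑ (stem d ++ q d 0 i)
stem-turn-⊑ d i = ⊑-++ˡ (stem d) (head-⊑ (q-hd d 0 i))

stem-turn-∈ : ∀ d i → treeOf d (stem d ++ (i ∷ []))
stem-turn-∈ d i = 1 , (λ _ → i) ,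
  subst ((stem d ++ (i ∷ [])) ⊑_) (cong (stem d ++_) (sym (++-identityʳ (q d 0 i)))) (stem-turn-⊑ d i)

prependPath : Bool → (ℕ → Bool) → ℕ → Bool
prependPath i g zero = i
prependPath i g (suc k) = g k

restrict-arrowD : ∀ d i → restrict (treeOf d) (stem d ++ (i ∷ [])) ≐ treeOf (arrowD d i)
restrict-arrowD d i = into , back
  where
  node : Str
  node = stem d ++ (i ∷ [])
  tail : (ℕ → Bool) → ℕ → Str
  tail f M = blocks (λ k → q d (suc k)) (λ k → f (suc k)) M
  into : restrict (treeOf d) node ⊆ treeOf (arrowD d i)
  into x (_ , inj₂ x⊑node) =
    0 , (λ _ → false) , ⊑-trans x⊑node (subst (node ⊑_) (sym (++-identityʳ _)) (stem-turn-⊑ d i))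
  into x ((zero , f , x⊑) , inj₁ node⊑x) with ⊑-cancelˡ (stem d) (⊑-trans node⊑x x⊑)
  ... | _ , ()
  into x ((suc M , f , x⊑) , inj₁ node⊑x) =
    M , (λ k → f (suc k)) ,
    subst (λ j → x ⊑ ((stem d ++ q d 0 j) ++ tail f M)) f0≡i (subst (x ⊑_) (sym (++-assoc (stem d) _ _)) x⊑)
    where
    f0≡i : f 0 ≡ i
    f0≡i = head-agrees (tail f M) (q-hd d 0 (f 0)) (⊑-cancelˡ (stem d) (⊑-trans node⊑x x⊑))
  back : treeOf (arrowD d i) ⊆ restrict (treeOf d) node
  back x (M , g , x⊑) =
    (suc M , prependPath i g , subst (x ⊑_) (++-assoc (stem d) _ _) x⊑) ,
    ⊑-comparable x⊑ (⊑-trans (stem-turn-⊑ d i) (⊑-++ _ _))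

arrow-treeOf : ∀ s T d → T ≐ treeOf d → arrow T d s ≐ treeOf (arrowsD d s)
arrow-treeOf [] T d h = h
arrow-treeOf (i ∷ s) T d h =
  arrow-treeOf s _ (arrowD d i) (≐-trans (restrict-cong _ h) (restrict-arrowD d i))

arrow-P : ∀ {P} → LargeTreeForcing P → ∀ s T d → T ≐ treeOf d → P T → P (arrow T d s)
arrow-P F [] T d h pT = pT
arrow-P F (i ∷ s) T d h pT =
  arrow-P F s _ (arrowD d i) (≐-trans (restrict-cong _ h) (restrict-arrowD d i))
    (LargeTreeForcing.restrCl F T _ pT (proj₂ h _ (stem-turn-∈ d i)))

arrow-⊆ : ∀ s T d → arrow T d s ⊆ T
arrow-⊆ [] T d = λ t p → p
arrow-⊆ (i ∷ s) T d = ⊆-trans (arrow-⊆ s _ (arrowD d i)) (λ t p → proj₁ p)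

arrowsD-q : ∀ s d k i → q (arrowsD d s) k i ≡ q d (length s + k) i
arrowsD-q [] d k i = refl
arrowsD-q (j ∷ s) d k i = arrowsD-q s (arrowD d j) k i

-- The path through the blocks chosen by a finite string (false beyond it).
pathOf : Str → ℕ → Bool
pathOf [] _ = false
pathOf (b ∷ _) zero = b
pathOf (_ ∷ s) (suc k) = pathOf s k

pathOf-last : ∀ m (u : Vec Bool (suc m)) → pathOf (toList u) m ≡ last u
pathOf-last zero (x ∷ᵥ []ᵥ) = refl
pathOf-last (suc m) (x ∷ᵥ xs) = pathOf-last m xs

arrowsD-stem : ∀ s d → stem (arrowsD d s) ≡ stem d ++ blocks (q d) (pathOf s) (length s)
arrowsD-stem [] d = sym (++-identityʳ _)
arrowsD-stem (i ∷ s) d = trans (arrowsD-stem s (arrowD d i)) (++-assoc (stem d) _ _)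

spl-arrowD : ∀ d i k → spl (arrowD d i) k ≡ spl d (suc k)
spl-arrowD d false zero = length-++ (stem d)
spl-arrowD d true zero = trans (length-++ (stem d)) (cong (length (stem d) +_) (sym (q-len d 0)))
spl-arrowD d i (suc k) = cong (_+ length (q d (suc k) false)) (spl-arrowD d i k)

arrowsD-stem-length : ∀ s d → length (stem (arrowsD d s)) ≡ spl d (length s)
arrowsD-stem-length [] d = refl
arrowsD-stem-length (i ∷ s) d = trans (arrowsD-stem-length s (arrowD d i)) (spl-arrowD d i (length s))

-- Blocks are nonempty, so splitting levels grow at least linearly.
spl-≥ : ∀ d k → k ≤ spl d k
spl-≥ d zero = z≤n
spl-≥ d (suc k) with q d k false | q-hd d k false
... | .(false ∷ r) | sw r =
  subst (suc k ≤_) (sym (+-suc (spl d k) (length r))) (s≤s (≤-trans (spl-≥ d k) (m≤m+n (spl d k) (length r))))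

stem-⊑ : ∀ d {x} → treeOf d x → length (stem d) ≤ length x → stem d ⊑ x
stem-⊑ d (M , f , p) l = ⊑-shorter p (⊑-++ (stem d) _) l

cover : ∀ n d x → treeOf d x → ∃ λ (u : Vec Bool n) → ∃ λ y → x ⊑ y × treeOf (arrowsD d (toList u)) y
cover zero d x h = []ᵥ , x , ⊑-refl x , h
cover (suc n) d x (M , f , p) with cover n (arrowD d (f 0)) _ (M , (λ k → f (suc k)) , ⊑-refl _)
... | u , y , y₀⊑y , y∈ =
  f 0 ∷ᵥ u , y , ⊑-trans x⊑y₀ (subst (_⊑ y) (++-assoc (stem d) _ _) y₀⊑y) , y∈
  where
  x⊑y₀ : x ⊑ (stem d ++ blocks (q d) f (suc M))
  x⊑y₀ = ⊑-trans p (⊑-++ˡ (stem d) (blocks-prefix (q d) f M))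

-- Translations of generated trees and E₀-relatedness of cones

translate-stem : ∀ d τ a → length τ ≤ length a →
  treeOf (withStem d (dotS τ a)) ≐ dotT τ (treeOf (withStem d a))
translate-stem d τ a l = into , back
  where
  l' : length τ ≤ length (dotS τ a)
  l' = subst (length τ ≤_) (sym (dotS-length τ a)) l
  into : treeOf (withStem d (dotS τ a)) ⊆ dotT τ (treeOf (withStem d a))
  into x (M , f , p) = dotS τ x , (M , f , subst (dotS τ x ⊑_) untranslate (dotS-mono τ p)) , sym (dotS-involutive τ x)
    where
    untranslate : dotS τ (dotS τ a ++ blocks (q d) f M) ≡ a ++ blocks (q d) f M
    untranslate = trans (dotS-++ τ (dotS τ a) _ l') (cong (_++ _) (dotS-involutive τ a))
  back : dotT τ (treeOf (withStem d a)) ⊆ treeOf (withStem d (dotS τ a))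
  back x (t , (M , f , p) , refl) = M , f , subst (dotS τ t ⊑_) (dotS-++ τ a _ l) (dotS-mono τ p)

arrow-translate : ∀ T d u v → T ≐ treeOf d → length u ≡ length v →
  arrow T d v ≐ dotT (dotS (stem (arrowsD d u)) (stem (arrowsD d v))) (arrow T d u)
arrow-translate T d u v h luv =
  ≐-trans (arrow-treeOf v T d h)
  (≐-trans (treeOf-ext (arrowsD d v) (withStem du (dotS τ cu)) (sym carry) same-q)
  (≐-trans (translate-stem du τ cu (≤-reflexive lτ))
           (dotT-cong τ (≐-sym (arrow-treeOf u T d h)))))
  where
  du : LTData
  du = arrowsD d u
  cu cv τ : Str
  cu = stem du
  cv = stem (arrowsD d v)
  τ = dotS cu cv
  equal-length : length cu ≡ length cv
  equal-length = trans (arrowsD-stem-length u d) (trans (cong (spl d) luv) (sym (arrowsD-stem-length v d)))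
  carry : dotS τ cu ≡ cv
  carry = dotS-difference cu cv equal-length
  lτ : length τ ≡ length cu
  lτ = trans (dotS-length cu cv) (sym equal-length)
  same-q : ∀ k i → q (arrowsD d v) k i ≡ q du k i
  same-q k i = trans (arrowsD-q v d k i) (trans (cong (λ z → q d (z + k) i) (sym luv)) (sym (arrowsD-q u d k i)))

cones-condProd : ∀ {P n T d} → LC n P T d → ∀ (s t : Vec Bool n) →
  CondProd P (arrow T d (toList s)) (arrow T d (toList t))
cones-condProd lc s t =
  proj₂ lc s , proj₂ lc t , _ ,
  arrow-translate _ _ (toList s) (toList t) (proj₂ (proj₁ lc)) (trans (length-toList s) (sym (length-toList t)))

arrow-stem-⊑ : ∀ {T d} → T ≐ treeOf d → ∀ s {x} → arrow T d s x → spl d (length s) ≤ length x →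
  stem (arrowsD d s) ⊑ x
arrow-stem-⊑ {T} {d} h s {x} x∈ l =
  stem-⊑ (arrowsD d s) (proj₁ (arrow-treeOf s T d h) x x∈) (subst (_≤ length x) (sym (arrowsD-stem-length s d)) l)

-- Grafting

-- Splitting strings of a graft at level m: those of q below level m, the level-m
-- blocks q^m_i lengthened by tails e_i, and those of B from level m+1 on.
graftQ : ℕ → (ℕ → Bool → Str) → (Bool → Str) → (ℕ → Bool → Str) → ℕ → Bool → Str
graftQ zero q e B zero i = q 0 i ++ e i
graftQ zero q e B (suc j) i = B j i
graftQ (suc m) q e B zero i = q 0 i
graftQ (suc m) q e B (suc j) i = graftQ m (λ k → q (suc k)) e B j i

graftQ-below : ∀ m q e B j i → j < m → graftQ m q e B j i ≡ q j i
graftQ-below (suc m) q e B zero i l = refl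
graftQ-below (suc m) q e B (suc j) i (s≤s l) = graftQ-below m (λ k → q (suc k)) e B j i l

graftQ-above : ∀ m q e B k i → graftQ m q e B (suc m + k) i ≡ B k i
graftQ-above zero q e B k i = refl
graftQ-above (suc m) q e B k i = graftQ-above m (λ k → q (suc k)) e B k i

graftQ-length : ∀ m q e B → (∀ k → length (q k false) ≡ length (q k true)) →
  length (e false) ≡ length (e true) → (∀ k → length (B k false) ≡ length (B k true)) →
  ∀ k → length (graftQ m q e B k false) ≡ length (graftQ m q e B k true)
graftQ-length zero q e B hq he hB zero =
  trans (length-++ (q 0 false)) (trans (cong₂ _+_ (hq 0) he) (sym (length-++ (q 0 true))))
graftQ-length zero q e B hq he hB (suc k) = hB k
graftQ-length (suc m) q e B hq he hB zero = hq 0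
graftQ-length (suc m) q e B hq he hB (suc k) = graftQ-length m (λ k → q (suc k)) e B (λ k → hq (suc k)) he hB k

startsWith-++ : ∀ {i x} y → StartsWith i x → StartsWith i (x ++ y)
startsWith-++ y (sw r) = sw (r ++ y)

graftQ-head : ∀ m q e B → (∀ k i → StartsWith i (q k i)) → (∀ k i → StartsWith i (B k i)) →
  ∀ k i → StartsWith i (graftQ m q e B k i)
graftQ-head zero q e B hq hB zero i = startsWith-++ (e i) (hq 0 i)
graftQ-head zero q e B hq hB (suc k) i = hB k i
graftQ-head (suc m) q e B hq hB zero i = hq 0 i
graftQ-head (suc m) q e B hq hB (suc k) i = graftQ-head m (λ k → q (suc k)) e B (λ k → hq (suc k)) hB k i

blocks-graftQ : ∀ m q e B f → blocks (graftQ m q e B) f (suc m) ≡ blocks q f (suc m) ++ e (f m)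
blocks-graftQ zero q e B f = trans (++-identityʳ _) (cong (_++ e (f 0)) (sym (++-identityʳ _)))
blocks-graftQ (suc m) q e B f =
  trans (cong (q 0 (f 0) ++_) (blocks-graftQ m (λ k → q (suc k)) e B (λ k → f (suc k))))
        (sym (++-assoc (q 0 (f 0)) _ _))

graftD : (d : LTData) → ℕ → (e : Bool → Str) → length (e false) ≡ length (e true) → LTData → LTData
graftD d m e he dB = record
  { stem  = stem d
  ; q     = graftQ m (q d) e (q dB)
  ; q-len = graftQ-length m (q d) e (q dB) (q-len d) he (q-len dB)
  ; q-hd  = graftQ-head m (q d) e (q dB) (q-hd d) (q-hd dB)
  }

spl-agree : ∀ d d' k → length (stem d) ≡ length (stem d') →
  (∀ j → j < k → q d j false ≡ q d' j false) → spl d k ≡ spl d' k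
spl-agree d d' zero hs hq = hs
spl-agree d d' (suc k) hs hq =
  cong₂ _+_ (spl-agree d d' k hs (λ j l → hq j (≤-trans l (n≤1+n k)))) (cong length (hq k (n<1+n k)))

Refines : (Tree → Set) → ℕ → Tree → LTData → Tree → LTData → Set
Refines P n Q dQ Q' dQ' =
  LC n P Q' dQ' × SubN n Q' dQ' Q dQ × (∀ (u : Vec Bool n) → arrow Q' dQ' (toList u) ⊆ arrow Q dQ (toList u))

module Grafting {P : Tree → Set} (F : LargeTreeForcing P) (m : ℕ) {Q : Tree} {dQ : LTData}
  (lcQ : LC (suc m) P Q dQ) (dB : LTData) (ℓ : ℕ) where

  coneStem : Vec Bool (suc m) → Str
  coneStem u = stem (arrowsD dQ (toList u))

  L : ℕ
  L = spl dQ (suc m)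

  coneStem-length : ∀ u → length (coneStem u) ≡ L
  coneStem-length u = trans (arrowsD-stem-length (toList u) dQ) (cong (spl dQ) (length-toList u))

  -- The material grafted in direction b: a condition below a cone Q(→ u) with
  -- u(m) = b, generated by the splitting strings of dB above a stem of length ℓ
  -- extending the stem of that cone.
  record Side (b : Bool) : Set₁ where
    field
      node            : Vec Bool (suc m)
      node-last       : last node ≡ b
      tree            : Tree
      treeStem        : Str
      tree-gen        : tree ≐ treeOf (withStem dB treeStem)
      tree-P          : P tree
      tree-⊆          : tree ⊆ arrow Q dQ (toList node)
      cone-⊑          : coneStem node ⊑ treeStem
      treeStem-length : length treeStem ≡ ℓ

  module _ (side : ∀ b → Side b) where
    open Side

    w : Bool → Vec Bool (suc m)
    w b = node (side b)

    R : Bool → Tree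
    R b = tree (side b)

    e : Bool → Str
    e b = proj₁ (cone-⊑ (side b))

    e-spec : ∀ b → coneStem (w b) ++ e b ≡ treeStem (side b)
    e-spec b = proj₂ (cone-⊑ (side b))

    e-length : ∀ b → L + length (e b) ≡ ℓ
    e-length b = trans (cong (_+ length (e b)) (sym (coneStem-length (w b))))
      (trans (sym (length-++ (coneStem (w b)))) (trans (cong length (e-spec b)) (treeStem-length (side b))))

    e-equal : length (e false) ≡ length (e true)
    e-equal = +-cancelˡ-≡ L _ _ (trans (e-length false) (sym (e-length true)))

    dQ' : LTData
    dQ' = graftD dQ m e e-equal dB

    Q' : Tree
    Q' = treeOf dQ'

    graft-coneStem : ∀ u → stem (arrowsD dQ' (toList u)) ≡ coneStem u ++ e (last u)
    graft-coneStem u = begin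
        stem (arrowsD dQ' (toList u))
      ≡⟨ arrowsD-stem (toList u) dQ' ⟩
        stem dQ ++ blocks (q dQ') f (length (toList u))
      ≡⟨ cong (λ z → stem dQ ++ blocks (q dQ') f z) (length-toList u) ⟩
        stem dQ ++ blocks (q dQ') f (suc m)
      ≡⟨ cong (stem dQ ++_) (blocks-graftQ m (q dQ) e (q dB) f) ⟩
        stem dQ ++ (blocks (q dQ) f (suc m) ++ e (f m))
      ≡⟨ sym (++-assoc (stem dQ) _ _) ⟩
        (stem dQ ++ blocks (q dQ) f (suc m)) ++ e (f m)
      ≡⟨ cong₂ _++_ (sym (trans (arrowsD-stem (toList u) dQ) (cong (λ z → stem dQ ++ blocks (q dQ) f z) (length-toList u))))
                    (cong e (pathOf-last m u)) ⟩
        coneStem u ++ e (last u)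
      ∎
      where
      open ≡-Reasoning
      f : ℕ → Bool
      f = pathOf (toList u)

    graft-cone : ∀ u → arrow Q' dQ' (toList u) ≐ treeOf (withStem dB (coneStem u ++ e (last u)))
    graft-cone u = ≐-trans (arrow-treeOf (toList u) Q' dQ' ≐-refl)
      (treeOf-ext (arrowsD dQ' (toList u)) (withStem dB (coneStem u ++ e (last u))) (graft-coneStem u) upper)
      where
      upper : ∀ k i → q (arrowsD dQ' (toList u)) k i ≡ q dB k i
      upper k i = trans (arrowsD-q (toList u) dQ' k i)
        (trans (cong (λ z → graftQ m (q dQ) e (q dB) (z + k) i) (length-toList u)) (graftQ-above m (q dQ) e (q dB) k i))

    graft-cone-side : ∀ b → arrow Q' dQ' (toList (w b)) ≐ R b
    graft-cone-side b = ≐-trans (graft-cone (w b))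
      (≐-trans (treeOf-ext (withStem dB _) (withStem dB _) stems (λ _ _ → refl)) (≐-sym (tree-gen (side b))))
      where
      stems : coneStem (w b) ++ e (last (w b)) ≡ treeStem (side b)
      stems = trans (cong (λ c → coneStem (w b) ++ e c) (node-last (side b))) (e-spec b)

    -- The cone Q'(→ u) is the translate of the side in direction u(m) that
    -- carries the stem of Q(→ w(u(m))) to that of Q(→ u).
    shift : Vec Bool (suc m) → Str
    shift u = dotS (coneStem (w (last u))) (coneStem u)

    graft-cone-translate : ∀ u → arrow Q' dQ' (toList u) ≐ dotT (shift u) (R (last u))
    graft-cone-translate u =
      ≐-trans (graft-cone u)
      (≐-trans (treeOf-ext (withStem dB _) (withStem dB _) stems (λ _ _ → refl))
      (≐-trans (translate-stem dB (shift u) (treeStem (side b)) shift≤)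
               (dotT-cong (shift u) (≐-sym (tree-gen (side b))))))
      where
      b : Bool
      b = last u
      equal-length : length (coneStem (w b)) ≡ length (coneStem u)
      equal-length = trans (coneStem-length (w b)) (sym (coneStem-length u))
      shift-length : length (shift u) ≡ L
      shift-length = trans (dotS-length (coneStem (w b)) (coneStem u)) (coneStem-length u)
      stems : coneStem u ++ e b ≡ dotS (shift u) (treeStem (side b))
      stems = sym (begin
          dotS (shift u) (treeStem (side b))
        ≡⟨ cong (dotS (shift u)) (sym (e-spec b)) ⟩
          dotS (shift u) (coneStem (w b) ++ e b)
        ≡⟨ dotS-++ (shift u) (coneStem (w b)) (e b) (≤-reflexive (trans shift-length (sym (coneStem-length (w b))))) ⟩
          dotS (shift u) (coneStem (w b)) ++ e b
        ≡⟨ cong (_++ e b) (dotS-difference (coneStem (w b)) (coneStem u) equal-length) ⟩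
          coneStem u ++ e b
        ∎)
        where open ≡-Reasoning
      shift≤ : length (shift u) ≤ length (treeStem (side b))
      shift≤ = subst (length (shift u) ≤_) (trans (e-length b) (sym (treeStem-length (side b))))
        (subst (_≤ L + length (e b)) (sym shift-length) (m≤m+n L (length (e b))))

    -- Cones shrink: σ·R(b) ⊆ σ·Q(→ w b) = Q(→ u).
    graft-cone-⊆ : ∀ u → arrow Q' dQ' (toList u) ⊆ arrow Q dQ (toList u)
    graft-cone-⊆ u =
      ⊆-trans (proj₁ (graft-cone-translate u))
      (⊆-trans (dotT-mono (shift u) (tree-⊆ (side (last u))))
               (proj₂ (arrow-translate Q dQ (toList (w (last u))) (toList u) (proj₂ (proj₁ lcQ))
                        (trans (length-toList (w (last u))) (sym (length-toList u))))))

    -- Cones are conditions, being translates of conditions.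
    graft-cone-P : ∀ u → P (arrow Q' dQ' (toList u))
    graft-cone-P u = LargeTreeForcing.ext F _ _ (≐-sym (graft-cone-translate u))
      (LargeTreeForcing.dotCl F _ (shift u) (tree-P (side (last u))))

    -- Q' ⊆ Q: every node of Q' lies below a node of a cone of Q', hence below a
    -- node of Q, and Q is closed under initial segments.
    graft-⊆ : Q' ⊆ Q
    graft-⊆ x x∈ with cover (suc m) dQ' x x∈
    ... | u , y , x⊑y , y∈ = proj₁ (proj₂ (proj₁ (proj₁ lcQ))) x y x⊑y
      (arrow-⊆ (toList u) Q dQ y (graft-cone-⊆ u y (proj₂ (arrow-treeOf (toList u) Q' dQ' ≐-refl) y y∈)))

    -- Only levels ≥ m were changed, so the first m+1 splitting levels agree.
    graft-spl : ∀ k → k < suc m → spl dQ' k ≡ spl dQ k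
    graft-spl k (s≤s k≤m) = spl-agree dQ' dQ k refl (λ j j<k → graftQ-below m (q dQ) e (q dB) j false (<-≤-trans j<k k≤m))

    graft : Σ Tree λ Q'' → Σ LTData λ dQ'' → Refines P (suc m) Q dQ Q'' dQ'' ×
      (∀ b → arrow Q'' dQ'' (toList (w b)) ≐ R b)
    graft = Q' , dQ' , (((treeOf-perfect dQ' , ≐-refl) , graft-cone-P) , (graft-⊆ , graft-spl) , graft-cone-⊆) ,
            graft-cone-side

-- Handling pairs of cones

deep-cone : ∀ {P} → LargeTreeForcing P → ∀ {S} → P S → ∀ K →
  Σ Tree λ S₀ → Σ LTData λ d₀ → S₀ ⊆ S × P S₀ × S₀ ≐ treeOf d₀ × K ≤ length (stem d₀)
deep-cone F {S} PS K with LargeTreeForcing.inLT F S PS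
... | dS , _ , S≐ =
  arrow S dS zeros , arrowsD dS zeros , arrow-⊆ zeros S dS , arrow-P F zeros S dS S≐ PS , arrow-treeOf zeros S dS S≐ ,
  subst (_≤ length (stem (arrowsD dS zeros))) (length-replicate K)
    (subst (length zeros ≤_) (sym (arrowsD-stem-length zeros dS)) (spl-≥ dS (length zeros)))
  where
  zeros : Str
  zeros = replicate K false

both : ∀ {a} {X : Bool → Set a} b → X b → X (not b) → ∀ c → X c
both false x y false = x
both false x y true  = y
both true  x y false = y
both true  x y true  = x

both-at : ∀ {a p} {X : Bool → Set a} (Φ : ∀ c → X c → Set p) b (x : X b) (y : X (not b)) →
  (∀ c → Φ c (both b x y c)) → Φ b x × Φ (not b) y
both-at Φ false x y h = h false , h true
both-at Φ true  x y h = h true , h false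

subN-refl : ∀ {n T dT} → SubN n T dT T dT
subN-refl = (λ t p → p) , (λ k _ → refl)

refines-refl : ∀ {P n Q dQ} → LC n P Q dQ → Refines P n Q dQ Q dQ
refines-refl lc = lc , subN-refl , (λ u t p → p)

subN-trans : ∀ {n S dS T dT U dU} → SubN n S dS T dT → SubN n T dT U dU → SubN n S dS U dU
subN-trans (S⊆T , splST) (T⊆U , splTU) = ⊆-trans S⊆T T⊆U , (λ k k<n → trans (splST k k<n) (splTU k k<n))

module Fusion {P : Tree → Set} (F : LargeTreeForcing P) (m : ℕ) (D : Tree → Tree → Set) (OD : OpenDense P D) where

  D-ext : ∀ S S' T T' → S ≐ T → S' ≐ T' → D S S' → D T T'
  D-ext = proj₁ (proj₂ OD)

  D-dense : ∀ T T' → CondProd P T T' → ∃ λ S → ∃ λ S' → CondProd P S S' × D S S' × (S , S') ≤₂ (T , T')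
  D-dense = proj₁ (proj₂ (proj₂ OD))

  D-open : ∀ S S' T T' → D T T' → CondProd P S S' → (S , S') ≤₂ (T , T') → D S S'
  D-open = proj₂ (proj₂ (proj₂ OD))

  Cone : Tree → LTData → Vec Bool (suc m) → Tree
  Cone Q dQ u = arrow Q dQ (toList u)

  Handles : Tree → LTData → Vec Bool (suc m) → Vec Bool (suc m) → Set
  Handles Q dQ s t = last s ≢ last t → D (Cone Q dQ s) (Cone Q dQ t)

  -- Handled pairs stay handled under refinement, as D is open.
  handles-refine : ∀ {Q dQ Q' dQ'} → Refines P (suc m) Q dQ Q' dQ' →
    ∀ {s t} → Handles Q dQ s t → Handles Q' dQ' s t
  handles-refine (lc' , _ , cone-⊆) {s} {t} h different =
    D-open _ _ _ _ (h different) (cones-condProd {P} lc' s t) (cone-⊆ s , cone-⊆ t)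

  handle-new-pair : ∀ {Q dQ} → LC (suc m) P Q dQ → ∀ s t → last s ≢ last t →
    Σ Tree λ Q' → Σ LTData λ dQ' → Refines P (suc m) Q dQ Q' dQ' × D (Cone Q' dQ' s) (Cone Q' dQ' t)
  handle-new-pair {Q} {dQ} lc s t different with D-dense _ _ (cones-condProd {P} lc s t)
  ... | S , S' , (PS , _ , σ , S'≐σS) , DSS' , (S⊆ , S'⊆) with deep-cone F PS (spl dQ (suc m) + length σ)
  ... | S₀ , d₀ , S₀⊆S , PS₀ , S₀≐ , long = realise (graft sides)
    where
    open Grafting F m lc d₀ (length (stem d₀)) using (Side; graft)
    a : Str
    a = stem d₀
    level≤a : spl dQ (suc m) ≤ length a
    level≤a = ≤-trans (m≤m+n _ (length σ)) long
    σ≤a : length σ ≤ length a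
    σ≤a = ≤-trans (m≤n+m (length σ) _) long
    level≤ : ∀ (u : Vec Bool (suc m)) x → spl dQ (suc m) ≤ length x → spl dQ (length (toList u)) ≤ length x
    level≤ u x = subst (λ k → spl dQ k ≤ length x) (sym (length-toList u))
    σS₀⊆S' : dotT σ S₀ ⊆ S'
    σS₀⊆S' = ⊆-trans (dotT-mono σ S₀⊆S) (proj₂ S'≐σS)
    PσS₀ : P (dotT σ S₀)
    PσS₀ = LargeTreeForcing.dotCl F S₀ σ PS₀
    -- ⟨S₀, σ·S₀⟩ extends ⟨S, S'⟩, so it lies in D.
    D₀ : D S₀ (dotT σ S₀)
    D₀ = D-open S₀ (dotT σ S₀) S S' DSS' (PS₀ , PσS₀ , σ , ≐-refl) (S₀⊆S , σS₀⊆S')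
    a∈S₀ : S₀ a
    a∈S₀ = proj₂ S₀≐ a (0 , (λ _ → false) , ⊑-++ a [])
    sideS : Side (last s)
    sideS = record
      { node = s ; node-last = refl ; tree = S₀ ; treeStem = a ; tree-gen = S₀≐ ; tree-P = PS₀
      ; tree-⊆ = ⊆-trans S₀⊆S S⊆
      ; cone-⊑ = arrow-stem-⊑ (proj₂ (proj₁ lc)) (toList s) (S⊆ a (S₀⊆S a a∈S₀)) (level≤ s a level≤a)
      ; treeStem-length = refl }
    sideT : Side (not (last s))
    sideT = record
      { node = t ; node-last = ¬-not (λ e → different (sym e)) ; tree = dotT σ S₀ ; treeStem = dotS σ a
      ; tree-gen = ≐-trans (dotT-cong σ S₀≐) (≐-sym (translate-stem d₀ σ a σ≤a)) ; tree-P = PσS₀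
      ; tree-⊆ = ⊆-trans σS₀⊆S' S'⊆
      ; cone-⊑ = arrow-stem-⊑ (proj₂ (proj₁ lc)) (toList t) (S'⊆ _ (σS₀⊆S' _ (a , a∈S₀ , refl)))
                   (level≤ t (dotS σ a) (subst (spl dQ (suc m) ≤_) (sym (dotS-length σ a)) level≤a))
      ; treeStem-length = dotS-length σ a }
    sides : ∀ c → Side c
    sides = both (last s) sideS sideT
    realise : (Σ Tree λ Q' → Σ LTData λ dQ' → Refines P (suc m) Q dQ Q' dQ' ×
        (∀ c → arrow Q' dQ' (toList (Side.node (sides c))) ≐ Side.tree (sides c))) →
      Σ Tree λ Q' → Σ LTData λ dQ' → Refines P (suc m) Q dQ Q' dQ' × D (Cone Q' dQ' s) (Cone Q' dQ' t)
    realise (Q' , dQ' , refines , realised) with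
      both-at (λ c side → arrow Q' dQ' (toList (Side.node side)) ≐ Side.tree side) (last s) sideS sideT realised
    ... | at-s , at-t = Q' , dQ' , refines , D-ext _ _ _ _ (≐-sym at-s) (≐-sym at-t) D₀

  handle-pair : ∀ {Q dQ} → LC (suc m) P Q dQ → ∀ s t →
    Σ Tree λ Q' → Σ LTData λ dQ' → Refines P (suc m) Q dQ Q' dQ' × Handles Q' dQ' s t
  handle-pair {Q} {dQ} lc s t with last s ≟ last t
  ... | yes same = Q , dQ , refines-refl {P} lc , λ different → contradiction same different
  ... | no different = weaken (handle-new-pair lc s t different)
    where
    weaken : (Σ Tree λ Q' → Σ LTData λ dQ' → Refines P (suc m) Q dQ Q' dQ' × D (Cone Q' dQ' s) (Cone Q' dQ' t)) →
      Σ Tree λ Q' → Σ LTData λ dQ' → Refines P (suc m) Q dQ Q' dQ' × Handles Q' dQ' s t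
    weaken (Q' , dQ' , refines , handled) = Q' , dQ' , refines , λ _ → handled

  handle-all : ∀ {T dT} → LC (suc m) P T dT → ∀ pairs →
    Σ Tree λ Q → Σ LTData λ dQ → LC (suc m) P Q dQ × SubN (suc m) Q dQ T dT × All (uncurry (Handles Q dQ)) pairs
  handle-all {T} {dT} lcT [] = T , dT , lcT , subN-refl , []
  handle-all lcT ((s , t) ∷ pairs) with handle-all lcT pairs
  ... | Q , dQ , lcQ , sub , handled with handle-pair lcQ s t
  ...   | Q' , dQ' , refines , new =
    Q' , dQ' , proj₁ refines , subN-trans (proj₁ (proj₂ refines)) sub , new ∷ All.map (handles-refine refines) handled

vectors : (n : ℕ) → List (Vec Bool n)
vectors zero = []ᵥ ∷ []
vectors (suc n) = map (false ∷ᵥ_) (vectors n) ++ map (true ∷ᵥ_) (vectors n)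

vectors-complete : ∀ {n} (u : Vec Bool n) → u ∈ vectors n
vectors-complete []ᵥ = here refl
vectors-complete (false ∷ᵥ u) = ∈-++⁺ˡ (∈-map⁺ (false ∷ᵥ_) (vectors-complete u))
vectors-complete (true ∷ᵥ u) = ∈-++⁺ʳ _ (∈-map⁺ (true ∷ᵥ_) (vectors-complete u))

-- Handle the list of all pairs of level-(m+1) directions at once.
lemma5p2 : (P : Tree → Set) → LargeTreeForcing P → (m : ℕ) →
    (T : Tree) → (dT : LTData) → LC (suc m) P T dT →
    (D : Tree → Tree → Set) → OpenDense P D →
    Σ Tree λ Q → Σ LTData λ dQ →
      LC (suc m) P Q dQ × SubN (suc m) Q dQ T dT ×
      (∀ (s t : Vec Bool (suc m)) → last s ≢ last t →
        D (arrow Q dQ (toList s)) (arrow Q dQ (toList t)))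
lemma5p2 P F m T dT lcT D OD
  with Fusion.handle-all F m D OD lcT (cartesianProduct (vectors (suc m)) (vectors (suc m)))
... | Q , dQ , lcQ , sub , handled =
  Q , dQ , lcQ , sub , λ s t → All.lookup handled (∈-cartesianProduct⁺ (vectors-complete s) (vectors-complete t))
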